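{- For a $k$-uniform hypergraph $G(V,E)$, $\chi^c(G)\ge \log_2\left\lceil \frac{|V|}{\gamma(G)}\right\rceil$.
   Context: A bicoloring of $G$ is a map $X:V\to\{0,1\}$; a bicoloring cover of $G$ is a set of bicolorings such that every hyperedge is non-monochromatic under at least one of them; $\chi^c(G)$ is the minimum size of a bicoloring cover. For an optimal bicoloring cover $C=\{X_1,\dots,X_{\chi^c(G)}\}$, each vertex $v$ gets the color bit vector $(X_1(v),\dots,X_{\chi^c(G)}(v))$, and $\gamma_C(G)$ is the maximum number of vertices sharing a common bit vector. The cover independence number $\gamma(G)$ is the maximum of $\gamma_C(G)$ over all bicoloring covers $C$ of size $\chi^c(G)$. -}

module Defs where

open import Data.Nat using (ℕ; _+_; _∸_; _≤_; _<_; NonZero)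
open import Data.Nat.DivMod using (_/_)
open import Data.Bool using (Bool)
open import Data.Bool.Properties using () renaming (_≟_ to _≟ᵇ_)
open import Data.Fin using (Fin)
open import Data.Fin.Subset using (Subset; _∈_; ∣_∣)
open import Data.Fin.Properties using (all?)
open import Data.List using (List; length; filter)
open import Data.List.Base using (allFin)
open import Data.Product using (Σ; ∃; _×_; _,_)
open import Relation.Binary.PropositionalEquality using (_≡_; _≢_)

record Hypergraph (n : ℕ) : Set where
  field
    m     : ℕ
    edge  : Fin m → Subset n

open Hypergraph public

Uniform : ∀ {n} → ℕ → Hypergraph n → Set
Uniform k G = ∀ j → ∣ edge G j ∣ ≡ k

Bicoloring : ℕ → Set
Bicoloring n = Fin n → Bool

NonMono : ∀ {n} → Bicoloring n → Subset n → Set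
NonMono X e = Σ _ λ u → Σ _ λ v → u ∈ e × v ∈ e × X u ≢ X v

IsCover : ∀ {n} {c : ℕ} → Hypergraph n → (Fin c → Bicoloring n) → Set
IsCover {c = c} G C = ∀ j → ∃ λ (i : Fin c) → NonMono (C i) (edge G j)

IsChiC : ∀ {n} → Hypergraph n → ℕ → Set
IsChiC {n} G c =
  (∃ λ (C : Fin c → Bicoloring n) → IsCover G C) ×
  (∀ c' → c' < c → (C : Fin c' → Bicoloring n) → IsCover G C → Data.Empty.⊥)
  where import Data.Empty

classCount : ∀ {n c} → (Fin c → Bicoloring n) → (Fin c → Bool) → ℕ
classCount {n} C b = length (filter (λ v → all? (λ i → C i v ≟ᵇ b i)) (allFin n))

IsGammaC : ∀ {n c} → (Fin c → Bicoloring n) → ℕ → Set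
IsGammaC {c = c} C g = (∃ λ (b : Fin c → Bool) → classCount C b ≡ g) × (∀ b → classCount C b ≤ g)

IsGamma : ∀ {n} → Hypergraph n → ℕ → ℕ → Set
IsGamma {n} G c g =
  (∃ λ (C : Fin c → Bicoloring n) → IsCover G C × IsGammaC C g) ×
  (∀ (C : Fin c → Bicoloring n) g' → IsCover G C → IsGammaC C g' → g' ≤ g)

ceilDiv : (a b : ℕ) → .{{NonZero b}} → ℕ
ceilDiv a b = (a + b ∸ 1) / b

module Submission where

-- Let C = (X₁,…,X_c) be a bicoloring cover of size c = χ^c(G)
-- realising γ(G) = g, i.e. every colour bit vector b ∈ {0,1}^c is shared by
-- at most g vertices.  The 2^c bit vectors partition V, so the pigeonhole
-- principle gives |V| ≤ 2^c · g, hence ⌈|V| / g⌉ ≤ 2^c and, since ⌈log₂⌉ is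
-- monotone, ⌈log₂ ⌈|V| / g⌉⌉ ≤ c.

open import Defs
open import Data.Nat using (ℕ; _≤_; NonZero)
open import Data.Nat.Logarithm using (⌈log₂_⌉)

open import Data.Nat using (zero; suc; _+_; _*_; _∸_; _^_)
open import Data.Nat.Properties
open import Data.Nat.DivMod using (_/_; /-monoˡ-≤; +-distrib-/-∣ˡ; m*n/n≡m; m<n⇒m/n≡0)
open import Data.Nat.Divisibility using (divides)
open import Data.Nat.Logarithm using (⌈log₂⌉-mono-≤; ⌈log₂2^n⌉≡n)
open import Data.Bool using (Bool; true; false)
open import Data.Bool.Properties using () renaming (_≟_ to _≟ᵇ_)
open import Data.Fin using (Fin) renaming (zero to fzero; suc to fsuc)
open import Data.Fin.Properties using (all?)
open import Data.List using (List; []; _∷_; length; filter)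
open import Data.List.Base using (allFin)
open import Data.List.Properties using (filter-≐; filter-all; length-tabulate)
open import Data.List.Relation.Unary.All as All using ()
open import Data.Vec.Functional using (Vector; head; tail) renaming (_∷_ to _∷ᵥ_)
open import Data.Product using (_×_; _,_)
open import Relation.Nullary using (yes; no)
open import Relation.Nullary.Decidable using (_×-dec_)
open import Level using (0ℓ)
open import Relation.Unary using (Pred; Decidable)
open import Relation.Binary.PropositionalEquality

filter-filter : ∀ {a p q} {A : Set a} {P : Pred A p} {Q : Pred A q} (P? : Decidable P) (Q? : Decidable Q) (xs : List A) →
  filter P? (filter Q? xs) ≡ filter (λ x → Q? x ×-dec P? x) xs
filter-filter P? Q? [] = refl
filter-filter P? Q? (x ∷ xs) with Q? x
... | no _ = filter-filter P? Q? xs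
... | yes _ with P? x
...   | no _ = filter-filter P? Q? xs
...   | yes _ = cong (x ∷_) (filter-filter P? Q? xs)

length-split-Bool : ∀ {a} {A : Set a} (f : A → Bool) (xs : List A) →
  length xs ≡ length (filter (λ x → f x ≟ᵇ false) xs) + length (filter (λ x → f x ≟ᵇ true) xs)
length-split-Bool f [] = refl
length-split-Bool f (x ∷ xs) with f x
... | false = cong suc (length-split-Bool f xs)
... | true  = trans (cong suc (length-split-Bool f xs)) (sym (+-suc _ _))

-- The colour bit vector of v under the family C equals b.  Its decision
-- procedure is exactly the test used by `classCount` in the definitions.
HasColour : ∀ {n c} → (Fin c → Bicoloring n) → Vector Bool c → Pred (Fin n) 0ℓ
HasColour C b v = ∀ i → C i v ≡ b i

hasColour? : ∀ {n c} (C : Fin c → Bicoloring n) (b : Vector Bool c) → Decidable (HasColour C b)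
hasColour? C b v = all? (λ i → C i v ≟ᵇ b i)

classCountIn : ∀ {n c} → (Fin c → Bicoloring n) → Vector Bool c → List (Fin n) → ℕ
classCountIn C b vs = length (filter (hasColour? C b) vs)

classCountIn-tail : ∀ {n c} (C : Fin (suc c) → Bicoloring n) x b (vs : List (Fin n)) →
  classCountIn (tail C) b (filter (λ v → head C v ≟ᵇ x) vs) ≡ classCountIn C (x ∷ᵥ b) vs
classCountIn-tail C x b vs = cong length (begin
    filter (hasColour? (tail C) b) (filter (λ v → head C v ≟ᵇ x) vs)
      ≡⟨ filter-filter (hasColour? (tail C) b) (λ v → head C v ≟ᵇ x) vs ⟩
    filter (λ v → (head C v ≟ᵇ x) ×-dec hasColour? (tail C) b v) vs
      ≡⟨ filter-≐ _ _ (split-colour , join-colour) vs ⟩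
    filter (hasColour? C (x ∷ᵥ b)) vs ∎)
  where
  open ≡-Reasoning
  split-colour : ∀ {v} → head C v ≡ x × HasColour (tail C) b v → HasColour C (x ∷ᵥ b) v
  split-colour (first , rest) fzero    = first
  split-colour (first , rest) (fsuc i) = rest i
  join-colour : ∀ {v} → HasColour C (x ∷ᵥ b) v → head C v ≡ x × HasColour (tail C) b v
  join-colour h = h fzero , λ i → h (fsuc i)

pigeonhole : ∀ {n} c (C : Fin c → Bicoloring n) g (vs : List (Fin n)) →
  (∀ b → classCountIn C b vs ≤ g) → length vs ≤ 2 ^ c * g
pigeonhole zero C g vs bounded = begin
    length vs                   ≡⟨ cong length (filter-all (hasColour? C (λ ())) (All.universal (λ _ ()) vs)) ⟨
    classCountIn C (λ ()) vs   ≤⟨ bounded (λ ()) ⟩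
    g                           ≡⟨ +-identityʳ g ⟨
    2 ^ 0 * g                   ∎
  where open ≤-Reasoning
pigeonhole (suc c) C g vs bounded = begin
    length vs                                  ≡⟨ length-split-Bool (head C) vs ⟩
    length (part false) + length (part true)   ≤⟨ +-mono-≤ (part-bound false) (part-bound true) ⟩
    2 ^ c * g + 2 ^ c * g                      ≡⟨ cong (2 ^ c * g +_) (+-identityʳ (2 ^ c * g)) ⟨
    2 * (2 ^ c * g)                            ≡⟨ *-assoc 2 (2 ^ c) g ⟨
    2 ^ suc c * g                              ∎
  where
  open ≤-Reasoning
  part : Bool → List _
  part x = filter (λ v → head C v ≟ᵇ x) vs
  part-bound : ∀ x → length (part x) ≤ 2 ^ c * g
  part-bound x = pigeonhole c (tail C) g (part x) λ b →
    ≤-trans (≤-reflexive (classCountIn-tail C x b vs)) (bounded (x ∷ᵥ b))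

vertices≤classes : ∀ {n c} (C : Fin c → Bicoloring n) g → (∀ b → classCount C b ≤ g) → n ≤ 2 ^ c * g
vertices≤classes {n} {c} C g bounded =
  ≤-trans (≤-reflexive (sym (length-tabulate {n = n} (λ v → v))))
          (pigeonhole c C g (allFin n) bounded)

ceilDiv-≤ : ∀ n m g → .{{_ : NonZero g}} → n ≤ m * g → ceilDiv n g ≤ m
ceilDiv-≤ n m g@(suc g-1) n≤mg = begin
    (n + g ∸ 1) / g          ≤⟨ /-monoˡ-≤ g (∸-monoˡ-≤ 1 (+-monoˡ-≤ g n≤mg)) ⟩
    (m * g + g ∸ 1) / g      ≡⟨ cong (λ z → (z ∸ 1) / g) (+-suc (m * g) g-1) ⟩
    (m * g + g-1) / g        ≡⟨ +-distrib-/-∣ˡ g-1 (divides m refl) ⟩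
    m * g / g + g-1 / g      ≡⟨ cong₂ _+_ (m*n/n≡m m g) (m<n⇒m/n≡0 (n<1+n g-1)) ⟩
    m + 0                    ≡⟨ +-identityʳ m ⟩
    m                        ∎
  where open ≤-Reasoning

theorem7 : ∀ (n k : ℕ) (G : Hypergraph n) → Uniform k G →
    ∀ (c g : ℕ) → IsChiC G c → IsGamma G c g → .{{_ : NonZero g}} →
    ⌈log₂ ceilDiv n g ⌉ ≤ c
theorem7 n k G _ c g _ ((C , _ , _ , classes≤g) , _) = begin
    ⌈log₂ ceilDiv n g ⌉   ≤⟨ ⌈log₂⌉-mono-≤ (ceilDiv-≤ n (2 ^ c) g (vertices≤classes C g classes≤g)) ⟩
    ⌈log₂ 2 ^ c ⌉         ≡⟨ ⌈log₂2^n⌉≡n c ⟩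
    c                     ∎
  where open ≤-Reasoning
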